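{- With respect to strong equivalence $\equiv_{s,a}$ of ASP programs: (1) the S-RP, S-DL and S-AD transformations are SE-preserving and NSE-preserving; (2) the S-RD-2 transformation is SE-preserving but not NSE-preserving; (3) the S-EX-1 transformation is NSE-preserving but not SE-preserving; (4) the S-RD-1 and S-EX-0 transformations are neither SE-preserving nor NSE-preserving.
   Context: Atoms are propositional. A rule $r$ is an expression $h_1\vee\cdots\vee h_k\leftarrow b_1,\dots,b_m,\mathit{not}\,c_1,\dots,\mathit{not}\,c_n$; write $H(r)$, $B^+(r)$, $B^-(r)$ for the sets of head, positive body and negative body atoms. A program is a finite set of rules. An interpretation $X$ satisfies $r$ iff $X\cap H(r)\neq\emptyset$ or $B^+(r)\not\subseteq X$ or $B^-(r)\cap X\neq\emptyset$. GL-reduct $P^X=\{H(r)\leftarrow B^+(r) : r\in P,\ B^-(r)\cap X=\emptyset\}$; $X$ is a stable model of $P$ iff $X\models P^X$ and no proper subset of $X$ satisfies $P^X$. $P\equiv_{s,a}Q$ iff for every program $R$, $P\cup R$ and $Q\cup R$ have the same stable models. Programs are regarded as tuples of rules (repetitions allowed); $\langle P,Q\rangle$ is the concatenation. For a tuple $T=\langle r_1,\dots,r_n\rangle$ with atom set $at(T)$, let $\langle S_1,\dots,S_{3n}\rangle=\langle H(r_1),B^+(r_1),B^-(r_1),\dots,H(r_n),B^+(r_n),B^-(r_n)\rangle$; for nonempty $N'\subseteq\{1,\dots,3n\}$ the independent set is $I_{N'}=\bigcap_{i\in N'}S_i\setminus\bigcup_{j\notin N'}S_j$. Let $I=I_{N'}$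 be an independent set and $a'\notin at(T)$ fresh. Replacing $a\in I$ by $a'$ renames every occurrence of $a$ in $T$; deleting $a\in I$ removes $a$ from every rule of $T$; adding $a'$ to $I$ adds $a'$ to each $S_i$, $i\in N'$. S-RP: replace some $a\in I$ by $a'$ ($|I|>0$); S-DL: delete some $a\in I$ ($|I|>2$); S-RD-$i$ ($i\in\{1,2\}$): delete some $a\in I$ ($|I|=i$); S-AD: add $a'$ to $I$ ($|I|\ge 2$); S-EX-$i$ ($i\in\{0,1\}$): add $a'$ to $I$ ($|I|=i$). For a pair $T=\langle P,Q\rangle$ the result is $\langle P^\circ,Q^\circ\rangle$ with $P^\circ$ the first $|P|$ rules. A transformation type is SE-preserving if for every pair $\langle P,Q\rangle$ and every admissible application $P\equiv_{s,a}Q$ implies $P^\circ\equiv_{s,a}Q^\circ$, and NSE-preserving if $P\not\equiv_{s,a}Q$ implies $P^\circ\not\equiv_{s,a}Q^\circ$. -}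

module Defs where

open import Data.Nat using (ℕ; _≟_; _≡ᵇ_)
open import Data.Bool using (Bool; true; false; if_then_else_)
open import Data.List using (List; []; _∷_; _++_; map; filter; zipWith; take; drop; length)
open import Data.List.Relation.Unary.Any using (Any)
open import Data.List.Relation.Unary.All using (All; all?)
open import Data.List.Relation.Binary.Pointwise using (Pointwise)
open import Data.List.Membership.Propositional using (_∈_; _∉_)
open import Data.List.Membership.DecPropositional _≟_ using (_∈?_)
open import Data.List.Relation.Binary.Subset.Propositional using (_⊆_)
open import Data.Product using (_×_; Σ; ∃; ∃-syntax; _,_)
open import Data.Sum using (_⊎_)
open import Relation.Nullary using (¬_; ¬?)
open import Relation.Binary.PropositionalEquality using (_≡_; _≢_)
open import Function.Bundles using (_⇔_)

-- Syntax. Atoms are natural numbers (a countably infinite supply, so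
-- fresh atoms always exist). Sets of atoms are represented by lists,
-- read up to membership.

Atom : Set
Atom = ℕ

record Rule : Set where
  constructor mkRule
  field
    H  : List Atom
    B⁺ : List Atom
    B⁻ : List Atom
open Rule public

-- programs as tuples (lists) of rules; P ∪ R is concatenation
Program : Set
Program = List Rule

Interp : Set
Interp = List Atom

_⊨r_ : Interp → Rule → Set
X ⊨r r = Any (_∈ X) (H r) ⊎ (¬ (B⁺ r ⊆ X) ⊎ Any (_∈ X) (B⁻ r))

_⊨_ : Interp → Program → Set
X ⊨ P = All (X ⊨r_) P

reduct : Program → Interp → Program
reduct P X =
  map (λ r → mkRule (H r) (B⁺ r) [])
      (filter (λ r → all? (λ c → ¬? (c ∈? X)) (B⁻ r)) P)

_⊂_ : Interp → Interp → Set
Y ⊂ X = (Y ⊆ X) × ¬ (X ⊆ Y)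

StableModel : Program → Interp → Set
StableModel P X = (X ⊨ reduct P X) × (∀ Y → Y ⊂ X → ¬ (Y ⊨ reduct P X))

_≡sa_ : Program → Program → Set
P ≡sa Q = ∀ (R : Program) (X : Interp) →
  StableModel (P ++ R) X ⇔ StableModel (Q ++ R) X

-- Independent sets.
-- The components S_{3k-2}, S_{3k-1}, S_{3k} of rule r_k are H, B⁺, B⁻.

data Comp : Set where
  hd pos neg : Comp

comp : Rule → Comp → List Atom
comp r hd  = H r
comp r pos = B⁺ r
comp r neg = B⁻ r

-- A subset N' ⊆ {1..3n} of positions of a tuple T is given as one mask
-- (Comp → Bool) per rule of T (Pointwise below forces equal length).
Mask : Set
Mask = Comp → Bool

NonEmptyN : List Mask → Set
NonEmptyN N = Any (λ m → ∃[ c ] m c ≡ true) N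

InI : Program → List Mask → Atom → Set
InI T N a = Pointwise (λ r m → ∀ c → (a ∈ comp r c ⇔ m c ≡ true)) T N

Occurs : Atom → Program → Set
Occurs a T = Any (λ r → ∃[ c ] a ∈ comp r c) T

Fresh : Atom → Program → Set
Fresh a T = ¬ Occurs a T

Card0 : Program → List Mask → Set
Card0 T N = ∀ b → ¬ InI T N b

Card1 : Program → List Mask → Atom → Set
Card1 T N a = InI T N a × (∀ b → InI T N b → b ≡ a)

Card2 : Program → List Mask → Atom → Set
Card2 T N a = ∃[ b ] (b ≢ a × InI T N a × InI T N b ×
                      (∀ c → InI T N c → c ≡ a ⊎ c ≡ b))

AtLeast2 : Program → List Mask → Set
AtLeast2 T N = ∃[ a ] ∃[ b ] (a ≢ b × InI T N a × InI T N b)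

AtLeast3 : Program → List Mask → Set
AtLeast3 T N = ∃[ a ] ∃[ b ] ∃[ c ]
  (a ≢ b × a ≢ c × b ≢ c × InI T N a × InI T N b × InI T N c)

mapRule : (List Atom → List Atom) → Rule → Rule
mapRule f r = mkRule (f (H r)) (f (B⁺ r)) (f (B⁻ r))

renameT : Atom → Atom → Program → Program
renameT a a' = map (mapRule (map (λ x → if x ≡ᵇ a then a' else x)))

deleteT : Atom → Program → Program
deleteT a = map (mapRule (filter (λ x → ¬? (x ≟ a))))

addT : List Mask → Atom → Program → Program
addT N a' = zipWith addR N
  where
  addIf : Bool → List Atom → List Atom
  addIf b xs = if b then a' ∷ xs else xs
  addR : Mask → Rule → Rule
  addR m r = mkRule (addIf (m hd) (H r)) (addIf (m pos) (B⁺ r)) (addIf (m neg) (B⁻ r))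

data TType : Set where
  S-RP S-DL S-RD-1 S-RD-2 S-AD S-EX-0 S-EX-1 : TType

Trans : TType → Program → Program → Set
Trans S-RP T T° = ∃[ N ] ∃[ a ] ∃[ a' ]
  (NonEmptyN N × InI T N a × Fresh a' T × T° ≡ renameT a a' T)
Trans S-DL T T° = ∃[ N ] ∃[ a ]
  (NonEmptyN N × AtLeast3 T N × InI T N a × T° ≡ deleteT a T)
Trans S-RD-1 T T° = ∃[ N ] ∃[ a ]
  (NonEmptyN N × Card1 T N a × T° ≡ deleteT a T)
Trans S-RD-2 T T° = ∃[ N ] ∃[ a ]
  (NonEmptyN N × Card2 T N a × T° ≡ deleteT a T)
Trans S-AD T T° = ∃[ N ] ∃[ a' ]
  (NonEmptyN N × length N ≡ length T × AtLeast2 T N × Fresh a' T × T° ≡ addT N a' T)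
Trans S-EX-0 T T° = ∃[ N ] ∃[ a' ]
  (NonEmptyN N × length N ≡ length T × Card0 T N × Fresh a' T × T° ≡ addT N a' T)
Trans S-EX-1 T T° = ∃[ N ] ∃[ a' ]
  (NonEmptyN N × length N ≡ length T × (∃[ b ] Card1 T N b) × Fresh a' T × T° ≡ addT N a' T)

-- applied to the pair ⟨P,Q⟩ (i.e. the tuple P ++ Q); P° is the first |P| rules
SEPreserving : TType → Set
SEPreserving τ = ∀ (P Q T° : Program) → Trans τ (P ++ Q) T° →
  P ≡sa Q → take (length P) T° ≡sa drop (length P) T°

NSEPreserving : TType → Set
NSEPreserving τ = ∀ (P Q T° : Program) → Trans τ (P ++ Q) T° →
  ¬ (P ≡sa Q) → ¬ (take (length P) T° ≡sa drop (length P) T°)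

{-# OPTIONS --safe #-}
-- Strong equivalence is equality of Turner's SE-models: pairs X ⊆ Y with Y ⊨ P and X ⊨ P^Y.
-- A rule only ever asks whether one of its components meets an interpretation or is contained
-- in it. Each positive case therefore supplies a monotone map φ on interpretations such that every
-- rule of one tuple makes on φ Z the same tests as its counterpart in the other tuple makes on Z;
-- SE-models correspond, and strong equivalence of the two halves transfers.
-- Renaming a to a fresh a′ is undone by giving a′ the value of a (and vice versa). Deleting a is
-- undone by letting a copy a second member b of I, which occurs exactly where a did. For the
-- converse, take members a, b, c of I and collapse them: a and b hold iff all three do, c iff one
-- does. Since a, b, c occur together, both tests survive, and after deleting a they are still
-- recorded, by b and by c. With |I| = 2 a single atom would have to record both, which is why
-- S-RD-2 fails to preserve non-equivalence. Adding a fresh atom is the inverse of deleting it.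
module Submission where

open import Defs
open import Data.Nat using (_≟_; _≡ᵇ_)
open import Data.Bool using (Bool; true; false; if_then_else_)
import Data.Bool as Bool
open import Data.Bool.Properties using (T-≡)
open import Data.Nat.Properties using (≡ᵇ⇒≡; ≡⇒≡ᵇ)
open import Data.List using (List; []; _∷_; _++_; [_]; map; filter; cartesianProductWith; take; drop; length)
open import Data.List.Relation.Unary.Any as Any using (Any; here; there; any?)
open import Data.List.Relation.Unary.All as All using (All; []; _∷_; all?)
open import Data.List.Relation.Unary.All.Properties
  using (¬Any⇒All¬; All¬⇒¬Any; ++⁺; ++⁻; map⁺; map⁻; cartesianProductWith⁺)
open import Data.List.Relation.Binary.Pointwise as PW using (Pointwise; []; _∷_)
open import Data.List.Membership.Propositional using (_∈_; _∉_; find; lose)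
open import Data.List.Membership.Propositional.Properties
  using (∈-filter⁺; ∈-filter⁻; ∈-cartesianProductWith⁺; ∈-map⁺; ∈-map⁻; ∈-++⁺ˡ; ∈-++⁺ʳ; ∈-++⁻; ++-∈⇔)
open import Data.List.Membership.DecPropositional _≟_ using (_∈?_)
open import Data.List.Relation.Binary.Subset.DecPropositional _≟_ using (_⊆_; _⊆?_)
open import Data.Product using (_×_; _,_; proj₁; proj₂; Σ; ∃-syntax)
open import Data.Sum using (_⊎_; inj₁; inj₂; [_,_]′)
import Data.Sum as Sum
import Data.Product as Product
open import Data.Sum.Function.Propositional using (_⊎-⇔_)
open import Data.Product.Function.NonDependent.Propositional using (_×-⇔_)
open import Data.Empty using (⊥-elim)
open import Function using (id; _∘_; case_of_)
open import Function.Bundles using (_⇔_; mk⇔; Equivalence)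
open import Function.Properties.Equivalence using () renaming (refl to ⇔-refl; sym to ⇔-sym; trans to ⇔-trans)
open import Function.Related.TypeIsomorphisms using (→-cong-⇔; ¬-cong-⇔)
open import Relation.Nullary using (¬_; ¬?; Dec; yes; no; does)
open import Relation.Nullary.Decidable as Dec using (_⊎-dec_; _→-dec_; _×-dec_; from-yes; from-no)
open import Relation.Binary.PropositionalEquality using (_≡_; _≢_; refl; subst; setoid; ≢-sym)

open Equivalence using (to; from)

Meets : List Atom → Interp → Set
Meets S Z = Any (_∈ Z) S

meets? : ∀ S Z → Dec (Meets S Z)
meets? S Z = any? (_∈? Z) S

-- X ⊨[ Y ] r means X ⊨ r^Y
_⊨[_]_ : Interp → Interp → Rule → Set
X ⊨[ Y ] r = ¬ Meets (B⁻ r) Y → Meets (H r) X ⊎ ¬ (B⁺ r ⊆ X)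

_⊨ᴾ[_]_ : Interp → Interp → Program → Set
X ⊨ᴾ[ Y ] P = All (X ⊨[ Y ]_) P

⊨ᴾ[]? : ∀ X Y P → Dec (X ⊨ᴾ[ Y ] P)
⊨ᴾ[]? X Y = all? λ r → ¬? (meets? (B⁻ r) Y) →-dec (meets? (H r) X ⊎-dec ¬? (B⁺ r ⊆? X))

⊨-reduct⇔ : ∀ P {X Y} → X ⊨ reduct P Y ⇔ X ⊨ᴾ[ Y ] P
⊨-reduct⇔ [] = mk⇔ (λ _ → []) (λ _ → [])
⊨-reduct⇔ (r ∷ P) {X} {Y} with all? (λ c → ¬? (c ∈? Y)) (B⁻ r)
... | yes B⁻∩Y=∅ = mk⇔ (λ { (s ∷ ss) → (λ _ → positive s) ∷ to (⊨-reduct⇔ P) ss })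
                        (λ { (s ∷ ss) → reductRule (s (All¬⇒¬Any B⁻∩Y=∅)) ∷ from (⊨-reduct⇔ P) ss })
  where
  positive : X ⊨r mkRule (H r) (B⁺ r) [] → Meets (H r) X ⊎ ¬ (B⁺ r ⊆ X)
  positive (inj₁ h)        = inj₁ h
  positive (inj₂ (inj₁ b)) = inj₂ b
  reductRule : Meets (H r) X ⊎ ¬ (B⁺ r ⊆ X) → X ⊨r mkRule (H r) (B⁺ r) []
  reductRule (inj₁ h) = inj₁ h
  reductRule (inj₂ b) = inj₂ (inj₁ b)
... | no B⁻∩Y≠∅ = mk⇔ (λ ss → (λ B⁻∩Y=∅ → ⊥-elim (B⁻∩Y≠∅ (¬Any⇒All¬ _ B⁻∩Y=∅))) ∷ to (⊨-reduct⇔ P) ss)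
                       (λ { (_ ∷ ss) → from (⊨-reduct⇔ P) ss })

⊨⇔⊨[self] : ∀ {X} r → X ⊨r r ⇔ X ⊨[ X ] r
⊨⇔⊨[self] {X} r = mk⇔ forward backward
  where
  forward : X ⊨r r → X ⊨[ X ] r
  forward (inj₁ h)        _   = inj₁ h
  forward (inj₂ (inj₁ b)) _   = inj₂ b
  forward (inj₂ (inj₂ n)) ¬n  = ⊥-elim (¬n n)
  backward : X ⊨[ X ] r → X ⊨r r
  backward s with meets? (B⁻ r) X
  ... | yes n  = inj₂ (inj₂ n)
  ... | no ¬n with s ¬n
  ...   | inj₁ h = inj₁ h
  ...   | inj₂ b = inj₂ (inj₁ b)

⊨⇔⊨ᴾ[self] : ∀ {X} P → X ⊨ P ⇔ X ⊨ᴾ[ X ] P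
⊨⇔⊨ᴾ[self] P = mk⇔ (All.map (to (⊨⇔⊨[self] _))) (All.map (from (⊨⇔⊨[self] _)))

⊨ᴾ[]-resp : ∀ {X Z Y} P → X ⊆ Z → Z ⊆ X → Z ⊨ᴾ[ Y ] P → X ⊨ᴾ[ Y ] P
⊨ᴾ[]-resp P X⊆Z Z⊆X = All.map λ s n → Sum.map (Any.map Z⊆X) (λ b B⁺⊆X → b (X⊆Z ∘ B⁺⊆X)) (s n)

⊨reduct-++⇔ : ∀ P {R X Y} → X ⊨ reduct (P ++ R) Y ⇔ (X ⊨ᴾ[ Y ] P × X ⊨ᴾ[ Y ] R)
⊨reduct-++⇔ P {R} = ⇔-trans (⊨-reduct⇔ (P ++ R)) (mk⇔ (++⁻ P) λ (p , r) → ++⁺ p r)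

SEModel : Program → Interp → Interp → Set
SEModel P X Y = Y ⊨ P × X ⊨ᴾ[ Y ] P

_≡se_ : Program → Program → Set
P ≡se Q = ∀ X Y → X ⊆ Y → SEModel P X Y ⇔ SEModel Q X Y

≡se-sym : ∀ {P Q} → P ≡se Q → Q ≡se P
≡se-sym P≡Q X Y X⊆Y = ⇔-sym (P≡Q X Y X⊆Y)

≡sa-sym : ∀ {P Q} → P ≡sa Q → Q ≡sa P
≡sa-sym P≡Q R X = ⇔-sym (P≡Q R X)

≡se⇒stable : ∀ {P Q} R {X} → P ≡se Q → StableModel (P ++ R) X → StableModel (Q ++ R) X
≡se⇒stable {P} {Q} R {X} P≡Q (X⊨ , minimal) = from (⊨reduct-++⇔ Q) (proj₂ X⊨Q , X⊨R) , Q-minimal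
  where
  X⊨P : X ⊨ᴾ[ X ] P
  X⊨P = proj₁ (to (⊨reduct-++⇔ P) X⊨)
  X⊨R : X ⊨ᴾ[ X ] R
  X⊨R = proj₂ (to (⊨reduct-++⇔ P) X⊨)
  X⊨Q : SEModel Q X X
  X⊨Q = to (P≡Q X X id) (from (⊨⇔⊨ᴾ[self] P) X⊨P , X⊨P)
  Q-minimal : ∀ Y → Y ⊂ X → ¬ (Y ⊨ reduct (Q ++ R) X)
  Q-minimal Y Y⊂X Y⊨ =
    let Y⊨Q , Y⊨R = to (⊨reduct-++⇔ Q) Y⊨
        Y⊨P       = proj₂ (from (P≡Q Y X (proj₁ Y⊂X)) (proj₁ X⊨Q , Y⊨Q))
    in minimal Y Y⊂X (from (⊨reduct-++⇔ P) (Y⊨P , Y⊨R))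

≡se⇒≡sa : ∀ {P Q} → P ≡se Q → P ≡sa Q
≡se⇒≡sa P≡Q R X = mk⇔ (≡se⇒stable R P≡Q) (≡se⇒stable R (≡se-sym P≡Q))

fact : Atom → Rule
fact y = mkRule [ y ] [] []

arrow : Atom → Atom → Rule
arrow y z = mkRule [ y ] [ z ] []

facts : List Atom → Program
facts = map fact

clique : List Atom → Program
clique D = cartesianProductWith arrow D D

Closed : List Atom → Interp → Set
Closed D X = ∀ {y z} → y ∈ D → z ∈ D → z ∈ X → y ∈ X

⊨[]-fact : ∀ {X Y y} → X ⊨[ Y ] fact y ⇔ y ∈ X
⊨[]-fact {X} {Y} {y} = mk⇔ forward (λ y∈X _ → inj₁ (here y∈X))
  where
  forward : X ⊨[ Y ] fact y → y ∈ X
  forward s with s (λ ())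
  ... | inj₁ (here y∈X) = y∈X
  ... | inj₂ []⊈X       = ⊥-elim ([]⊈X λ ())

⊨[]-arrow : ∀ {X Y y z} → X ⊨[ Y ] arrow y z ⇔ (z ∈ X → y ∈ X)
⊨[]-arrow {X} {Y} {y} {z} = mk⇔ forward backward
  where
  forward : X ⊨[ Y ] arrow y z → z ∈ X → y ∈ X
  forward s z∈X with s (λ ())
  ... | inj₁ (here y∈X) = y∈X
  ... | inj₂ [z]⊈X      = ⊥-elim ([z]⊈X λ { (here refl) → z∈X })
  backward : (z ∈ X → y ∈ X) → X ⊨[ Y ] arrow y z
  backward z⇒y _ with z ∈? X
  ... | yes z∈X = inj₁ (here (z⇒y z∈X))
  ... | no z∉X  = inj₂ λ [z]⊆X → z∉X ([z]⊆X (here refl))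

⊨ᴾ[]-facts : ∀ {X Y} L → X ⊨ᴾ[ Y ] facts L ⇔ L ⊆ X
⊨ᴾ[]-facts L = mk⇔ (λ s {y} y∈L → to ⊨[]-fact (All.lookup (map⁻ s) y∈L))
                 (λ L⊆X → map⁺ (All.tabulate λ y∈L → from ⊨[]-fact (L⊆X y∈L)))

⊨ᴾ[]-clique : ∀ {X Y} D → X ⊨ᴾ[ Y ] clique D ⇔ Closed D X
⊨ᴾ[]-clique D = mk⇔
  (λ s {y} {z} y∈D z∈D → to ⊨[]-arrow (All.lookup s (∈-cartesianProductWith⁺ arrow y∈D z∈D)))
  (λ closed → cartesianProductWith⁺ (setoid Atom) (setoid Atom) arrow D D
                λ y∈D z∈D → from ⊨[]-arrow (closed y∈D z∈D))

_∖_ : Interp → Interp → List Atom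
Y ∖ X = filter (λ y → ¬? (y ∈? X)) Y

∈-∖⁺ : ∀ {y Y X} → y ∈ Y → y ∉ X → y ∈ Y ∖ X
∈-∖⁺ = ∈-filter⁺ (λ y → ¬? (y ∈? _))

∈-∖⁻ : ∀ {y Y X} → y ∈ Y ∖ X → y ∈ Y × y ∉ X
∈-∖⁻ {Y = Y} = ∈-filter⁻ (λ y → ¬? (y ∈? _)) {xs = Y}

-- the context R of Turner's proof that ≡sa implies ≡se
separator : Interp → Interp → Program
separator X Y = facts X ++ clique (Y ∖ X)

facts-stable : ∀ P {Y} → Y ⊨ P → StableModel (P ++ facts Y) Y
facts-stable P {Y} Y⊨P =
  from (⊨reduct-++⇔ P) (to (⊨⇔⊨ᴾ[self] P) Y⊨P , from (⊨ᴾ[]-facts _) id) ,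
  λ Z (_ , Y⊈Z) Z⊨ → Y⊈Z (to (⊨ᴾ[]-facts Y) (proj₂ (to (⊨reduct-++⇔ P) Z⊨)))

stable-++⇒⊨ : ∀ P {R Y} → StableModel (P ++ R) Y → Y ⊨ P
stable-++⇒⊨ P (Y⊨ , _) = from (⊨⇔⊨ᴾ[self] P) (proj₁ (to (⊨reduct-++⇔ P) Y⊨))

≡sa⇒⊨ : ∀ {P Q Y} → P ≡sa Q → Y ⊨ P → Y ⊨ Q
≡sa⇒⊨ {P} {Q} {Y} P≡Q Y⊨P = stable-++⇒⊨ Q (to (P≡Q (facts Y) Y) (facts-stable P Y⊨P))

separator-stable : ∀ Q {X Y} → X ⊆ Y → Y ⊨ Q → ¬ (X ⊨ᴾ[ Y ] Q) → StableModel (Q ++ separator X Y) Y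
separator-stable Q {X} {Y} X⊆Y Y⊨Q X⊭Q =
  from (⊨reduct-++⇔ Q) (to (⊨⇔⊨ᴾ[self] Q) Y⊨Q , Y⊨sep) , minimal
  where
  Y⊨sep : Y ⊨ᴾ[ Y ] separator X Y
  Y⊨sep = ++⁺ (from (⊨ᴾ[]-facts X) X⊆Y) (from (⊨ᴾ[]-clique (Y ∖ X)) λ y∈Y∖X _ _ → proj₁ (∈-∖⁻ y∈Y∖X))
  minimal : ∀ Z → Z ⊂ Y → ¬ (Z ⊨ reduct (Q ++ separator X Y) Y)
  minimal Z (Z⊆Y , Y⊈Z) Z⊨ = X⊭Q (⊨ᴾ[]-resp Q X⊆Z Z⊆X Z⊨Q)
    where
    Z⊨Q   = proj₁ (to (⊨reduct-++⇔ Q) Z⊨)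
    Z⊨sep = proj₂ (to (⊨reduct-++⇔ Q) Z⊨)
    X⊆Z : X ⊆ Z
    X⊆Z = to (⊨ᴾ[]-facts X) (proj₁ (++⁻ (facts X) Z⊨sep))
    closed : Closed (Y ∖ X) Z
    closed = to (⊨ᴾ[]-clique (Y ∖ X)) (proj₂ (++⁻ (facts X) Z⊨sep))
    Z⊆X : Z ⊆ X
    Z⊆X {w} w∈Z with w ∈? X
    ... | yes w∈X = w∈X
    ... | no w∉X  = ⊥-elim (Y⊈Z Y⊆Z)
      where
      Y⊆Z : Y ⊆ Z
      Y⊆Z {y} y∈Y with y ∈? X
      ... | yes y∈X = X⊆Z y∈X
      ... | no y∉X  = closed (∈-∖⁺ y∈Y y∉X) (∈-∖⁺ (Z⊆Y w∈Z) w∉X) w∈Z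

separator-unstable : ∀ P {X Y} → X ⊂ Y → X ⊨ᴾ[ Y ] P → ¬ StableModel (P ++ separator X Y) Y
separator-unstable P {X} {Y} X⊂Y X⊨P (_ , minimal) =
  minimal X X⊂Y (from (⊨reduct-++⇔ P) (X⊨P , X⊨sep))
  where
  X⊨sep : X ⊨ᴾ[ Y ] separator X Y
  X⊨sep = ++⁺ (from (⊨ᴾ[]-facts _) id)
              (from (⊨ᴾ[]-clique (Y ∖ X)) λ _ z∈Y∖X z∈X → ⊥-elim (proj₂ (∈-∖⁻ {Y = Y} z∈Y∖X) z∈X))

≡sa⇒SEModel : ∀ {P Q X Y} → P ≡sa Q → X ⊆ Y → SEModel P X Y → SEModel Q X Y
≡sa⇒SEModel {P} {Q} {X} {Y} P≡Q X⊆Y (Y⊨P , X⊨P) = Y⊨Q , X⊨Q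
  where
  Y⊨Q : Y ⊨ Q
  Y⊨Q = ≡sa⇒⊨ P≡Q Y⊨P
  X⊨Q : X ⊨ᴾ[ Y ] Q
  X⊨Q with ⊨ᴾ[]? X Y Q
  ... | yes X⊨Q = X⊨Q
  ... | no X⊭Q  = ⊥-elim (separator-unstable P (X⊆Y , Y⊈X) X⊨P
                            (from (P≡Q (separator X Y) Y) (separator-stable Q X⊆Y Y⊨Q X⊭Q)))
    where
    Y⊈X : ¬ (Y ⊆ X)
    Y⊈X Y⊆X = X⊭Q (⊨ᴾ[]-resp Q X⊆Y Y⊆X (to (⊨⇔⊨ᴾ[self] Q) Y⊨Q))

≡sa⇒≡se : ∀ {P Q} → P ≡sa Q → P ≡se Q
≡sa⇒≡se {P} {Q} P≡Q X Y X⊆Y = mk⇔ (≡sa⇒SEModel P≡Q X⊆Y) (≡sa⇒SEModel (≡sa-sym {P} {Q} P≡Q) X⊆Y)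

SameTests : List Atom → List Atom → Interp → Interp → Set
SameTests S S′ Z Z′ = (Meets S Z ⇔ Meets S′ Z′) × (S ⊆ Z ⇔ S′ ⊆ Z′)

SameTests-trans : ∀ {S S′ S″ Z Z′ Z″} → SameTests S S′ Z Z′ → SameTests S′ S″ Z′ Z″ → SameTests S S″ Z Z″
SameTests-trans (m , s) (m′ , s′) = ⇔-trans m m′ , ⇔-trans s s′

Covers : List Atom → List Atom → Interp → Interp → Set
Covers S S′ Z Z′ = ∀ {s} → s ∈ S → ∃[ s′ ] s′ ∈ S′ × (s ∈ Z ⇔ s′ ∈ Z′)

covers⇒SameTests : ∀ {S S′ Z Z′} → Covers S S′ Z Z′ → Covers S′ S Z′ Z → SameTests S S′ Z Z′
covers⇒SameTests c c′ = mk⇔ (meets c) (meets c′) , mk⇔ (subset c′) (subset c)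
  where
  meets : ∀ {S S′ Z Z′} → Covers S S′ Z Z′ → Meets S Z → Meets S′ Z′
  meets c S∩Z with find S∩Z
  ... | s , s∈S , s∈Z with c s∈S
  ...   | s′ , s′∈S′ , s∈Z⇔s′∈Z′ = lose s′∈S′ (to s∈Z⇔s′∈Z′ s∈Z)
  subset : ∀ {S S′ Z Z′} → Covers S′ S Z′ Z → S ⊆ Z → S′ ⊆ Z′
  subset c′ S⊆Z s′∈S′ with c′ s′∈S′
  ... | s , s∈S , s′∈Z′⇔s∈Z = from s′∈Z′⇔s∈Z (S⊆Z s∈S)

SameTests-sym : ∀ {S S′ Z Z′} → SameTests S S′ Z Z′ → SameTests S′ S Z′ Z
SameTests-sym (m , s) = ⇔-sym m , ⇔-sym s

agree⇒SameTests : ∀ {S Z Z′} → (∀ {s} → s ∈ S → s ∈ Z ⇔ s ∈ Z′) → SameTests S S Z Z′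
agree⇒SameTests agree =
  covers⇒SameTests (λ s∈S → _ , s∈S , agree s∈S) (λ s∈S → _ , s∈S , ⇔-sym (agree s∈S))

map-SameTests : ∀ {f S Z Z′} → (∀ {s} → s ∈ S → s ∈ Z ⇔ f s ∈ Z′) → SameTests S (map f S) Z Z′
map-SameTests {f} agree = covers⇒SameTests
  (λ s∈S → _ , ∈-map⁺ f s∈S , agree s∈S)
  (λ t∈fS → case ∈-map⁻ f t∈fS of λ { (s , s∈S , refl) → s , s∈S , ⇔-sym (agree s∈S) })

RuleAgree : (Interp → Interp) → Rule → Rule → Set
RuleAgree φ r r′ = ∀ k Z → SameTests (comp r k) (comp r′ k) Z (φ Z)

⊨-agree : ∀ {φ r r′ Z} → RuleAgree φ r r′ → Z ⊨r r ⇔ φ Z ⊨r r′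
⊨-agree {Z = Z} agree =
  proj₁ (agree hd Z) ⊎-⇔ ¬-cong-⇔ (proj₂ (agree pos Z)) ⊎-⇔ proj₁ (agree neg Z)

⊨[]-agree : ∀ {φ r r′ X Y} → RuleAgree φ r r′ → X ⊨[ Y ] r ⇔ φ X ⊨[ φ Y ] r′
⊨[]-agree {X = X} {Y} agree =
  →-cong-⇔ (¬-cong-⇔ (proj₁ (agree neg Y))) (proj₁ (agree hd X) ⊎-⇔ ¬-cong-⇔ (proj₂ (agree pos X)))

All-cong : ∀ {A B : Rule → Set} {P P′} → Pointwise (λ r r′ → A r ⇔ B r′) P P′ → All A P ⇔ All B P′
All-cong []         = mk⇔ (λ _ → []) (λ _ → [])
All-cong (r⇔r′ ∷ P⇔P′) =
  mk⇔ (λ { (a ∷ as) → to r⇔r′ a ∷ to (All-cong P⇔P′) as })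
      (λ { (b ∷ bs) → from r⇔r′ b ∷ from (All-cong P⇔P′) bs })

SEModel-agree : ∀ {φ P P′ X Y} → Pointwise (RuleAgree φ) P P′ → SEModel P X Y ⇔ SEModel P′ (φ X) (φ Y)
SEModel-agree agree = All-cong (PW.map ⊨-agree agree) ×-⇔ All-cong (PW.map ⊨[]-agree agree)

Monotone : (Interp → Interp) → Set
Monotone φ = ∀ {X Y} → X ⊆ Y → φ X ⊆ φ Y

-- the SE-models of T₀ are those of T₁ read through φ
_◃_ : Program → Program → Set
T₀ ◃ T₁ = Σ (Interp → Interp) λ φ → Monotone φ × Pointwise (RuleAgree φ) T₀ T₁

≡se-reflect : ∀ {φ P₀ Q₀ P₁ Q₁} → Monotone φ →
              Pointwise (RuleAgree φ) P₀ P₁ → Pointwise (RuleAgree φ) Q₀ Q₁ → P₁ ≡se Q₁ → P₀ ≡se Q₀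
≡se-reflect {φ} mono P₀P₁ Q₀Q₁ P₁≡Q₁ X Y X⊆Y =
  ⇔-trans (SEModel-agree P₀P₁) (⇔-trans (P₁≡Q₁ (φ X) (φ Y) (mono X⊆Y)) (⇔-sym (SEModel-agree Q₀Q₁)))

Pointwise-split : ∀ {R : Rule → Rule → Set} P {Q T} → Pointwise R (P ++ Q) T →
                  Pointwise R P (take (length P) T) × Pointwise R Q (drop (length P) T)
Pointwise-split []      PQ∼T       = [] , PQ∼T
Pointwise-split (_ ∷ P) (r∼t ∷ PQ∼T) = Product.map₁ (r∼t ∷_) (Pointwise-split P PQ∼T)

◃-preserves-≡sa : ∀ P Q {T} → T ◃ (P ++ Q) → P ≡sa Q → take (length P) T ≡sa drop (length P) T
◃-preserves-≡sa P Q (_ , mono , T∼PQ) P≡Q =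
  let P° , Q° = Pointwise-split P (PW.symmetric id T∼PQ)
  in ≡se⇒≡sa (≡se-reflect mono (PW.symmetric id P°) (PW.symmetric id Q°) (≡sa⇒≡se P≡Q))

◃-preserves-≢sa : ∀ P Q {T} → (P ++ Q) ◃ T → ¬ (P ≡sa Q) → ¬ (take (length P) T ≡sa drop (length P) T)
◃-preserves-≢sa P Q (_ , mono , PQ∼T) P≢Q P°≡Q° =
  let P° , Q° = Pointwise-split P PQ∼T
  in P≢Q (≡se⇒≡sa (≡se-reflect mono P° Q° (≡sa⇒≡se P°≡Q°)))

SEPreserving-by : ∀ τ → (∀ {T T°} → Trans τ T T° → T° ◃ T) → SEPreserving τ
SEPreserving-by τ reflect P Q T° step = ◃-preserves-≡sa P Q (reflect step)

NSEPreserving-by : ∀ τ → (∀ {T T°} → Trans τ T T° → T ◃ T°) → NSEPreserving τ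
NSEPreserving-by τ reflect P Q T° step = ◃-preserves-≢sa P Q (reflect step)

Absent : Atom → Rule → Set
Absent a r = ∀ k → a ∉ comp r k

CoOccur : Atom → Atom → Rule → Set
CoOccur x y r = ∀ k → x ∈ comp r k ⇔ y ∈ comp r k

Shadow : Atom → Atom → List Atom → List Atom → Set
Shadow a b S S′ = (∀ {y} → y ≢ a → y ∈ S ⇔ y ∈ S′) × (a ∈ S ⊎ a ∈ S′ → b ∈ S × b ∈ S′)

ShadowRule : Atom → Atom → Rule → Rule → Set
ShadowRule a b r r′ = ∀ k → Shadow a b (comp r k) (comp r′ k)

Shadow-sym : ∀ {a b S S′} → Shadow a b S S′ → Shadow a b S′ S
Shadow-sym (off-a , at-a) = (λ y≢a → ⇔-sym (off-a y≢a)) , Product.swap ∘ at-a ∘ Sum.swap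

shadow-SameTests : ∀ {a b S S′ Z} → Shadow a b S S′ → (a ∈ Z ⇔ b ∈ Z) → SameTests S S′ Z Z
shadow-SameTests sh a⇔b = covers⇒SameTests (covers sh a⇔b) (covers (Shadow-sym sh) a⇔b)
  where
  covers : ∀ {a b S S′ Z} → Shadow a b S S′ → (a ∈ Z ⇔ b ∈ Z) → Covers S S′ Z Z
  covers {a} (off-a , at-a) a⇔b {s} s∈S with s ≟ a
  ... | yes refl = _ , proj₂ (at-a (inj₁ s∈S)) , a⇔b
  ... | no s≢a   = s , to (off-a s≢a) s∈S , ⇔-refl

shadow◃ : ∀ {φ a b T₀ T₁} → Monotone φ → (∀ Z → a ∈ φ Z ⇔ b ∈ φ Z) →
          All (λ r → RuleAgree φ r r) T₀ → Pointwise (ShadowRule a b) T₀ T₁ → T₀ ◃ T₁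
shadow◃ {φ} mono coherent invariant shadow = φ , mono , agree invariant shadow
  where
  agree : ∀ {T₀ T₁} → All (λ r → RuleAgree φ r r) T₀ → Pointwise (ShadowRule _ _) T₀ T₁ →
          Pointwise (RuleAgree φ) T₀ T₁
  agree []         []         = []
  agree (inv ∷ is) (sh ∷ shs) =
    (λ k Z → SameTests-trans (inv k Z) (shadow-SameTests (sh k) (coherent Z))) ∷ agree is shs

when : ∀ {A : Set} → Dec A → List Atom → List Atom
when d xs = if does d then xs else []

∈-when : ∀ {A : Set} (d : Dec A) {y xs} → y ∈ when d xs ⇔ (A × y ∈ xs)
∈-when (yes p) = mk⇔ (p ,_) proj₂
∈-when (no ¬p) = mk⇔ (λ ()) (λ (p , _) → ⊥-elim (¬p p))

∉[_] : ∀ {y} (a : Atom) → y ≢ a → y ∉ [ a ]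
∉[ a ] y≢a (here y≡a) = y≢a y≡a

identify : Atom → Atom → Interp → Interp
identify a b Z = Z ∖ [ a ] ++ when (b ∈? Z) [ a ]

∈-identify-≢ : ∀ {a b Z y} → y ≢ a → y ∈ identify a b Z ⇔ y ∈ Z
∈-identify-≢ {a} {b} {Z} {y} y≢a = mk⇔ forward (λ y∈Z → ∈-++⁺ˡ (∈-∖⁺ y∈Z (∉[ a ] y≢a)))
  where
  forward : y ∈ identify a b Z → y ∈ Z
  forward y∈ with ∈-++⁻ (Z ∖ [ a ]) y∈
  ... | inj₁ y∈Z∖a = proj₁ (∈-∖⁻ {Y = Z} y∈Z∖a)
  ... | inj₂ y∈a   = ⊥-elim (∉[ a ] y≢a (proj₂ (to (∈-when (b ∈? Z)) y∈a)))

∈-identify-a : ∀ {a b Z} → a ∈ identify a b Z ⇔ b ∈ Z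
∈-identify-a {a} {b} {Z} =
  mk⇔ forward (λ b∈Z → ∈-++⁺ʳ (Z ∖ [ a ]) (from (∈-when (b ∈? Z)) (b∈Z , here refl)))
  where
  forward : a ∈ identify a b Z → b ∈ Z
  forward a∈ with ∈-++⁻ (Z ∖ [ a ]) a∈
  ... | inj₁ a∈Z∖a = ⊥-elim (proj₂ (∈-∖⁻ {Y = Z} a∈Z∖a) (here refl))
  ... | inj₂ a∈a   = proj₁ (to (∈-when (b ∈? Z)) a∈a)

identify-mono : ∀ {a b} → Monotone (identify a b)
identify-mono {a} X⊆Y {y} y∈ with y ≟ a
... | yes refl = from ∈-identify-a (X⊆Y (to ∈-identify-a y∈))
... | no y≢a   = from (∈-identify-≢ y≢a) (X⊆Y (to (∈-identify-≢ y≢a) y∈))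

identify-coherent : ∀ {a b} → b ≢ a → ∀ Z → a ∈ identify a b Z ⇔ b ∈ identify a b Z
identify-coherent {a} {b} b≢a Z = ⇔-trans (∈-identify-a {a} {b} {Z}) (⇔-sym (∈-identify-≢ b≢a))

absent-invariant : ∀ {a b r} → Absent a r → RuleAgree (identify a b) r r
absent-invariant a∉r k Z =
  agree⇒SameTests λ s∈r → ⇔-sym (∈-identify-≢ λ { refl → a∉r k s∈r })

mapComps : (Comp → List Atom → List Atom) → Rule → Rule
mapComps G r = mkRule (G hd (H r)) (G pos (B⁺ r)) (G neg (B⁻ r))

comp-mapComps : ∀ (C : List Atom → List Atom → Set) G r →
                (∀ k → C (comp r k) (G k (comp r k))) → ∀ k → C (comp r k) (comp (mapComps G r) k)
comp-mapComps C G r c hd  = c hd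
comp-mapComps C G r c pos = c pos
comp-mapComps C G r c neg = c neg

Pointwise-map : ∀ {R : Rule → Rule → Set} {f} {T} → All (λ r → R r (f r)) T → Pointwise R T (map f T)
Pointwise-map []       = []
Pointwise-map (r∼fr ∷ rs) = r∼fr ∷ Pointwise-map rs

rename : Atom → Atom → Atom → Atom
rename a a′ x = if x ≡ᵇ a then a′ else x

rename-cases : ∀ a a′ x → (x ≡ a × rename a a′ x ≡ a′) ⊎ (x ≢ a × rename a a′ x ≡ x)
rename-cases a a′ x with x ≡ᵇ a in x≡ᵇa
... | true  = inj₁ (≡ᵇ⇒≡ x a (from T-≡ x≡ᵇa) , refl)
... | false = inj₂ ((λ x≡a → subst Bool.T x≡ᵇa (≡⇒≡ᵇ x a x≡a)) , refl)

renamed-mirror : ∀ {a a′ Z} x → rename a a′ x ∈ Z ⇔ x ∈ identify a a′ Z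
renamed-mirror {a} {a′} x with rename-cases a a′ x
... | inj₁ (refl , x↦a′) rewrite x↦a′ = ⇔-sym ∈-identify-a
... | inj₂ (x≢a , x↦x)   rewrite x↦x  = ⇔-sym (∈-identify-≢ x≢a)

original-mirror : ∀ {a a′ Z x} → x ≢ a′ → x ∈ Z ⇔ rename a a′ x ∈ identify a′ a Z
original-mirror {a} {a′} {x = x} x≢a′ with rename-cases a a′ x
... | inj₁ (refl , x↦a′) rewrite x↦a′ = ⇔-sym ∈-identify-a
... | inj₂ (x≢a , x↦x)   rewrite x↦x  = ⇔-sym (∈-identify-≢ x≢a′)

renameT◃ : ∀ a a′ T → renameT a a′ T ◃ T
renameT◃ a a′ T = identify a a′ , identify-mono , PW.symmetric id (Pointwise-map (All.tabulate λ {r} _ →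
  comp-mapComps (λ S S′ → ∀ Z → SameTests S′ S Z (identify a a′ Z)) (λ _ → map (rename a a′)) r
    λ k Z → SameTests-sym (map-SameTests λ {x} _ → ⇔-sym (renamed-mirror x))))

◃renameT : ∀ {a a′ T} → All (Absent a′) T → T ◃ renameT a a′ T
◃renameT {a} {a′} a′∉T = identify a′ a , identify-mono , Pointwise-map (All.map (λ {r} a′∉r →
  comp-mapComps (λ S S′ → ∀ Z → SameTests S S′ Z (identify a′ a Z)) (λ _ → map (rename a a′)) r
    λ k Z → map-SameTests λ {x} x∈r → original-mirror λ { refl → a′∉r k x∈r }) a′∉T)

erase : Atom → List Atom → List Atom
erase a = filter (λ x → ¬? (x ≟ a))

∈-erase⁺ : ∀ {a x S} → x ∈ S → x ≢ a → x ∈ erase a S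
∈-erase⁺ = ∈-filter⁺ (λ x → ¬? (x ≟ _))

∈-erase⁻ : ∀ {a x} S → x ∈ erase a S → x ∈ S × x ≢ a
∈-erase⁻ S = ∈-filter⁻ (λ x → ¬? (x ≟ _)) {xs = S}

erase-shadow : ∀ {a b S} → b ≢ a → (a ∈ S → b ∈ S) → Shadow a b (erase a S) S
erase-shadow {S = S} b≢a a⇒b =
  (λ y≢a → mk⇔ (proj₁ ∘ ∈-erase⁻ S) (λ y∈S → ∈-erase⁺ y∈S y≢a)) ,
  λ { (inj₁ a∈erased) → ⊥-elim (proj₂ (∈-erase⁻ S a∈erased) refl)
    ; (inj₂ a∈S)      → ∈-erase⁺ (a⇒b a∈S) b≢a , a⇒b a∈S }

erase-absent : ∀ {a} S → a ∉ erase a S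
erase-absent S a∈erased = proj₂ (∈-erase⁻ S a∈erased) refl

deleteT-shadow : ∀ {a b T} → b ≢ a → All (CoOccur a b) T → Pointwise (ShadowRule a b) (deleteT a T) T
deleteT-shadow {a} {b} b≢a a~b = PW.symmetric id (Pointwise-map (All.map (λ {r} a~b →
  comp-mapComps (λ S S′ → Shadow a b S′ S) (λ _ → erase a) r λ k → erase-shadow b≢a (to (a~b k))) a~b))

deleteT-absent : ∀ a T → All (Absent a) (deleteT a T)
deleteT-absent a T = map⁺ (All.tabulate λ {r} _ →
  comp-mapComps (λ _ S′ → a ∉ S′) (λ _ → erase a) r λ k → erase-absent (comp r k))

deleteT◃ : ∀ {a b T} → b ≢ a → All (CoOccur a b) T → deleteT a T ◃ T
deleteT◃ {a} {T = T} b≢a a~b =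
  shadow◃ identify-mono (identify-coherent b≢a) (All.map absent-invariant (deleteT-absent a T))
          (deleteT-shadow b≢a a~b)

module Collapse (a b c : Atom) (a≢c : a ≢ c) (b≢c : b ≢ c) where

  D : List Atom
  D = a ∷ b ∷ c ∷ []

  collapse : Interp → Interp
  collapse Z = Z ∖ D ++ when (D ⊆? Z) (a ∷ b ∷ []) ++ when (meets? D Z) [ c ]

  ∈-collapse : ∀ {Z y} → y ∈ collapse Z ⇔
               ((y ∈ Z × y ∉ D) ⊎ (D ⊆ Z × y ∈ a ∷ b ∷ []) ⊎ (Meets D Z × y ∈ [ c ]))
  ∈-collapse {Z} = ⇔-trans ++-∈⇔ (mk⇔ (∈-∖⁻ {Y = Z}) (λ (y∈Z , y∉D) → ∈-∖⁺ y∈Z y∉D)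
                                  ⊎-⇔ ⇔-trans ++-∈⇔ (∈-when (D ⊆? Z) ⊎-⇔ ∈-when (meets? D Z)))

  ab⊆D : a ∷ b ∷ [] ⊆ D
  ab⊆D (here y≡a)         = here y≡a
  ab⊆D (there (here y≡b)) = there (here y≡b)

  ab≢c : ∀ {y} → y ∈ a ∷ b ∷ [] → y ≢ c
  ab≢c (here refl)         = a≢c
  ab≢c (there (here refl)) = b≢c

  ∈-collapse-∉D : ∀ {Z y} → y ∉ D → y ∈ collapse Z ⇔ y ∈ Z
  ∈-collapse-∉D {Z} {y} y∉D = mk⇔ forward (λ y∈Z → from ∈-collapse (inj₁ (y∈Z , y∉D)))
    where
    forward : y ∈ collapse Z → y ∈ Z
    forward y∈ with to ∈-collapse y∈
    ... | inj₁ (y∈Z , _)             = y∈Z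
    ... | inj₂ (inj₁ (_ , y∈ab))     = ⊥-elim (y∉D (ab⊆D y∈ab))
    ... | inj₂ (inj₂ (_ , here y≡c)) = ⊥-elim (y∉D (there (there (here y≡c))))

  ∈-collapse-ab : ∀ {Z y} → y ∈ a ∷ b ∷ [] → y ∈ collapse Z ⇔ D ⊆ Z
  ∈-collapse-ab {Z} {y} y∈ab = mk⇔ forward (λ D⊆Z → from ∈-collapse (inj₂ (inj₁ (D⊆Z , y∈ab))))
    where
    forward : y ∈ collapse Z → D ⊆ Z
    forward y∈ with to ∈-collapse y∈
    ... | inj₁ (_ , y∉D)             = ⊥-elim (y∉D (ab⊆D y∈ab))
    ... | inj₂ (inj₁ (D⊆Z , _))      = D⊆Z
    ... | inj₂ (inj₂ (_ , here y≡c)) = ⊥-elim (ab≢c y∈ab y≡c)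

  ∈-collapse-c : ∀ {Z} → c ∈ collapse Z ⇔ Meets D Z
  ∈-collapse-c {Z} = mk⇔ forward (λ D∩Z → from ∈-collapse (inj₂ (inj₂ (D∩Z , here refl))))
    where
    forward : c ∈ collapse Z → Meets D Z
    forward c∈ with to ∈-collapse c∈
    ... | inj₁ (_ , c∉D)        = ⊥-elim (c∉D (there (there (here refl))))
    ... | inj₂ (inj₁ (D⊆Z , _)) = here (D⊆Z (here refl))
    ... | inj₂ (inj₂ (D∩Z , _)) = D∩Z

  collapse-mono : Monotone collapse
  collapse-mono X⊆Y y∈ = from ∈-collapse
    (Sum.map (Product.map₁ X⊆Y)
             (Sum.map (Product.map₁ λ D⊆X d∈D → X⊆Y (D⊆X d∈D)) (Product.map₁ (Any.map X⊆Y)))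
             (to ∈-collapse y∈))

  collapse-coherent : ∀ Z → a ∈ collapse Z ⇔ b ∈ collapse Z
  collapse-coherent Z = ⇔-trans (∈-collapse-ab {Z} (here refl)) (⇔-sym (∈-collapse-ab (there (here refl))))

  D⊆collapse : ∀ {Z} → D ⊆ Z → D ⊆ collapse Z
  D⊆collapse D⊆Z (here refl)                 = from (∈-collapse-ab (here refl)) D⊆Z
  D⊆collapse D⊆Z (there (here refl))         = from (∈-collapse-ab (there (here refl))) D⊆Z
  D⊆collapse D⊆Z (there (there (here refl))) = from ∈-collapse-c (here (D⊆Z (here refl)))

  covering-SameTests : ∀ {S Z} → D ⊆ S → SameTests S S Z (collapse Z)
  covering-SameTests {S} {Z} D⊆S = mk⇔ meets⇒ meets⇐ , mk⇔ ⊆⇒ ⊆⇐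
    where
    meets⇒ : Meets S Z → Meets S (collapse Z)
    meets⇒ S∩Z with find S∩Z
    ... | s , s∈S , s∈Z with s ∈? D
    ...   | yes s∈D = lose (D⊆S (there (there (here refl)))) (from ∈-collapse-c (lose s∈D s∈Z))
    ...   | no s∉D  = lose s∈S (from (∈-collapse-∉D s∉D) s∈Z)
    meets⇐ : Meets S (collapse Z) → Meets S Z
    meets⇐ S∩cZ with find S∩cZ
    ... | s , s∈S , s∈cZ with to ∈-collapse s∈cZ
    ...   | inj₁ (s∈Z , _)        = lose s∈S s∈Z
    ...   | inj₂ (inj₁ (D⊆Z , s∈ab)) = lose s∈S (D⊆Z (ab⊆D s∈ab))
    ...   | inj₂ (inj₂ (D∩Z , _)) with find D∩Z
    ...     | d , d∈D , d∈Z = lose (D⊆S d∈D) d∈Z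
    ⊆⇒ : S ⊆ Z → S ⊆ collapse Z
    ⊆⇒ S⊆Z {s} s∈S with s ∈? D
    ... | yes s∈D = D⊆collapse (S⊆Z ∘ D⊆S) s∈D
    ... | no s∉D  = from (∈-collapse-∉D s∉D) (S⊆Z s∈S)
    ⊆⇐ : S ⊆ collapse Z → S ⊆ Z
    ⊆⇐ S⊆cZ {s} s∈S with s ∈? D
    ... | yes s∈D = to (∈-collapse-ab (here refl)) (S⊆cZ (D⊆S (here refl))) s∈D
    ... | no s∉D  = to (∈-collapse-∉D s∉D) (S⊆cZ s∈S)

  disjoint-SameTests : ∀ {S Z} → (∀ {s} → s ∈ S → s ∉ D) → SameTests S S Z (collapse Z)
  disjoint-SameTests S∩D=∅ = agree⇒SameTests λ s∈S → ⇔-sym (∈-collapse-∉D (S∩D=∅ s∈S))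

  cooccur-SameTests : ∀ {S Z} → a ∈ S ⇔ b ∈ S → a ∈ S ⇔ c ∈ S → SameTests S S Z (collapse Z)
  cooccur-SameTests {S} a~b a~c with a ∈? S
  ... | yes a∈S = covering-SameTests λ
      { (here refl) → a∈S ; (there (here refl)) → to a~b a∈S ; (there (there (here refl))) → to a~c a∈S }
  ... | no a∉S = disjoint-SameTests λ s∈S s∈D → a∉S (case s∈D of λ
      { (here refl) → s∈S ; (there (here refl)) → from a~b s∈S ; (there (there (here refl))) → from a~c s∈S })

  collapse◃ : ∀ {T₀ T₁} → All (λ r → CoOccur a b r × CoOccur a c r) T₀ →
              Pointwise (ShadowRule a b) T₀ T₁ → T₀ ◃ T₁
  collapse◃ cooccur = shadow◃ collapse-mono collapse-coherent
    (All.map (λ (a~b , a~c) k Z → cooccur-SameTests (a~b k) (a~c k)) cooccur)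

◃deleteT : ∀ {a b c T} → b ≢ a → c ≢ a → b ≢ c →
           All (λ r → CoOccur a b r × CoOccur a c r) T → T ◃ deleteT a T
◃deleteT {a} {b} {c} b≢a c≢a b≢c cooccur =
  collapse◃ cooccur (PW.symmetric (λ sh k → Shadow-sym (sh k)) (deleteT-shadow b≢a (All.map proj₁ cooccur)))
  where open Collapse a b c (≢-sym c≢a) b≢c

addIf : Atom → Bool → List Atom → List Atom
addIf a′ β S = if β then a′ ∷ S else S

addIf-shadow : ∀ {a′ b S} β → (b ∈ S ⇔ β ≡ true) → a′ ∉ S → Shadow a′ b S (addIf a′ β S)
addIf-shadow true  b∈S _    =
  (λ y≢a′ → mk⇔ there λ { (here y≡a′) → ⊥-elim (y≢a′ y≡a′) ; (there y∈S) → y∈S }) ,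
  λ _ → from b∈S refl , there (from b∈S refl)
addIf-shadow false _   a′∉S = (λ _ → ⇔-refl) , ⊥-elim ∘ a′∉S ∘ Sum.[ id , id ]

addIf-cooccur : ∀ {a′ x S} β → (x ∈ S ⇔ β ≡ true) → a′ ∉ S → a′ ∈ addIf a′ β S ⇔ x ∈ addIf a′ β S
addIf-cooccur true  x∈S _    = mk⇔ (λ _ → there (from x∈S refl)) (λ _ → here refl)
addIf-cooccur false x∈S a′∉S = mk⇔ (⊥-elim ∘ a′∉S) (λ x∈ → case to x∈S x∈ of λ ())

-- addT's local rule operation is, by definition, mapComps (λ k → addIf a′ (m k)).
addT-shadow : ∀ {a′ b T N} → InI T N b → All (Absent a′) T → Pointwise (ShadowRule a′ b) T (addT N a′ T)
addT-shadow []                 []               = []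
addT-shadow {a′} {b} {r ∷ _} {m ∷ _} (b∈r ∷ b∈T) (a′∉r ∷ a′∉T) =
  comp-mapComps (Shadow a′ b) (λ k → addIf a′ (m k)) r (λ k → addIf-shadow (m k) (b∈r k) (a′∉r k))
  ∷ addT-shadow b∈T a′∉T

addT-cooccur : ∀ {a′ x T N} → InI T N x → All (Absent a′) T → All (CoOccur a′ x) (addT N a′ T)
addT-cooccur []               []               = []
addT-cooccur {a′} {x} {r ∷ _} {m ∷ _} (x∈r ∷ x∈T) (a′∉r ∷ a′∉T) =
  comp-mapComps (λ _ S′ → a′ ∈ S′ ⇔ x ∈ S′) (λ k → addIf a′ (m k)) r
                (λ k → addIf-cooccur (m k) (x∈r k) (a′∉r k))
  ∷ addT-cooccur x∈T a′∉T

◃addT : ∀ {a′ b T N} → b ≢ a′ → InI T N b → All (Absent a′) T → T ◃ addT N a′ T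
◃addT b≢a′ b∈I a′∉T =
  shadow◃ identify-mono (identify-coherent b≢a′) (All.map absent-invariant a′∉T) (addT-shadow b∈I a′∉T)

addT◃ : ∀ {a′ x y T N} → a′ ≢ y → x ≢ y → InI T N x → InI T N y → All (Absent a′) T → addT N a′ T ◃ T
addT◃ {a′} {x} {y} a′≢y x≢y x∈I y∈I a′∉T =
  collapse◃ (All.zip (addT-cooccur x∈I a′∉T , addT-cooccur y∈I a′∉T))
            (PW.symmetric (λ sh k → Shadow-sym (sh k)) (addT-shadow x∈I a′∉T))
  where open Collapse a′ x y a′≢y x≢y

InI-cooccur : ∀ {T N x y} → InI T N x → InI T N y → All (CoOccur x y) T
InI-cooccur []            []            = []
InI-cooccur (x∈r ∷ x∈T) (y∈r ∷ y∈T) = (λ k → ⇔-trans (x∈r k) (⇔-sym (y∈r k))) ∷ InI-cooccur x∈T y∈T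

InI-occurs : ∀ {T N x} → NonEmptyN N → InI T N x → Occurs x T
InI-occurs (here (k , m≡true)) (x∈r ∷ _)  = here (k , from (x∈r k) m≡true)
InI-occurs (there nonempty)    (_ ∷ x∈T) = there (InI-occurs nonempty x∈T)

Fresh⇒Absent : ∀ {a T} → Fresh a T → All (Absent a) T
Fresh⇒Absent {T = T} fresh = All.map (λ a∉r k a∈r → a∉r (k , a∈r)) (¬Any⇒All¬ T fresh)

occurs-fresh-≢ : ∀ {x a T} → Occurs x T → Fresh a T → x ≢ a
occurs-fresh-≢ occurs fresh refl = fresh occurs

two-others : ∀ {T N} a {x y z} → x ≢ y → x ≢ z → y ≢ z → InI T N x → InI T N y → InI T N z →
             ∃[ b ] ∃[ c ] (b ≢ a × c ≢ a × b ≢ c × InI T N b × InI T N c)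
two-others a {x} {y} x≢y x≢z y≢z x∈I y∈I z∈I with x ≟ a | y ≟ a
... | yes refl | _        = _ , _ , ≢-sym x≢y , ≢-sym x≢z , y≢z , y∈I , z∈I
... | no x≢a   | yes refl = _ , _ , x≢a , ≢-sym y≢z , x≢z , x∈I , z∈I
... | no x≢a   | no y≢a   = _ , _ , x≢a , y≢a , x≢y , x∈I , y∈I

S-RP-back : ∀ {T T°} → Trans S-RP T T° → T° ◃ T
S-RP-back (_ , a , a′ , _ , _ , _ , refl) = renameT◃ a a′ _

S-RP-forth : ∀ {T T°} → Trans S-RP T T° → T ◃ T°
S-RP-forth (_ , _ , _ , _ , _ , fresh , refl) = ◃renameT (Fresh⇒Absent fresh)

S-DL-back : ∀ {T T°} → Trans S-DL T T° → T° ◃ T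
S-DL-back (_ , a , _ , (_ , _ , _ , x≢y , x≢z , y≢z , x∈I , y∈I , z∈I) , a∈I , refl)
  with two-others a x≢y x≢z y≢z x∈I y∈I z∈I
... | _ , _ , b≢a , _ , _ , b∈I , _ = deleteT◃ b≢a (InI-cooccur a∈I b∈I)

S-DL-forth : ∀ {T T°} → Trans S-DL T T° → T ◃ T°
S-DL-forth (_ , a , _ , (_ , _ , _ , x≢y , x≢z , y≢z , x∈I , y∈I , z∈I) , a∈I , refl)
  with two-others a x≢y x≢z y≢z x∈I y∈I z∈I
... | _ , _ , b≢a , c≢a , b≢c , b∈I , c∈I =
  ◃deleteT b≢a c≢a b≢c (All.zip (InI-cooccur a∈I b∈I , InI-cooccur a∈I c∈I))

S-RD-2-back : ∀ {T T°} → Trans S-RD-2 T T° → T° ◃ T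
S-RD-2-back (_ , _ , _ , (_ , b≢a , a∈I , b∈I , _) , refl) = deleteT◃ b≢a (InI-cooccur a∈I b∈I)

S-AD-back : ∀ {T T°} → Trans S-AD T T° → T° ◃ T
S-AD-back (_ , _ , nonempty , _ , (_ , _ , x≢y , x∈I , y∈I) , fresh , refl) =
  addT◃ (≢-sym (occurs-fresh-≢ (InI-occurs nonempty y∈I) fresh)) x≢y x∈I y∈I (Fresh⇒Absent fresh)

S-AD-forth : ∀ {T T°} → Trans S-AD T T° → T ◃ T°
S-AD-forth (_ , _ , nonempty , _ , (_ , _ , _ , x∈I , _) , fresh , refl) =
  ◃addT (occurs-fresh-≢ (InI-occurs nonempty x∈I) fresh) x∈I (Fresh⇒Absent fresh)

S-EX-1-forth : ∀ {T T°} → Trans S-EX-1 T T° → T ◃ T°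
S-EX-1-forth (_ , _ , nonempty , _ , (_ , b∈I , _) , fresh , refl) =
  ◃addT (occurs-fresh-≢ (InI-occurs nonempty b∈I) fresh) b∈I (Fresh⇒Absent fresh)

∀-comp? : ∀ {P : Comp → Set} → (∀ k → Dec (P k)) → Dec (∀ k → P k)
∀-comp? P? = Dec.map (mk⇔ (λ (h , p , n) → λ { hd → h ; pos → p ; neg → n }) (λ f → f hd , f pos , f neg))
                     (P? hd ×-dec P? pos ×-dec P? neg)

∃-comp? : ∀ {P : Comp → Set} → (∀ k → Dec (P k)) → Dec (∃[ k ] P k)
∃-comp? P? = Dec.map (mk⇔ [ (hd ,_) , [ (pos ,_) , (neg ,_) ]′ ]′
                          (λ { (hd , p) → inj₁ p ; (pos , p) → inj₂ (inj₁ p) ; (neg , p) → inj₂ (inj₂ p) }))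
                     (P? hd ⊎-dec P? pos ⊎-dec P? neg)

_⇔?_ : ∀ {A B : Set} → Dec A → Dec B → Dec (A ⇔ B)
A? ⇔? B? = Dec.map (mk⇔ (λ (f , g) → mk⇔ f g) (λ A⇔B → to A⇔B , from A⇔B))
                   ((A? →-dec B?) ×-dec (B? →-dec A?))

InI? : ∀ T N x → Dec (InI T N x)
InI? T N x = PW.decidable (λ r m → ∀-comp? λ k → (x ∈? comp r k) ⇔? (m k Bool.≟ true)) T N

occurs? : ∀ x T → Dec (Occurs x T)
occurs? x = any? λ r → ∃-comp? λ k → x ∈? comp r k

SEModel? : ∀ P X Y → Dec (SEModel P X Y)
SEModel? P X Y = all? (λ r → meets? (H r) Y ⊎-dec ¬? (B⁺ r ⊆? Y) ⊎-dec meets? (B⁻ r) Y) P ×-dec ⊨ᴾ[]? X Y P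

≡sa-refl : ∀ P → P ≡sa P
≡sa-refl P R X = ⇔-refl

≡sa-by-SEModels : ∀ {P Q} → (∀ {X Y} → SEModel P X Y ⇔ SEModel Q X Y) → P ≡sa Q
≡sa-by-SEModels P⇔Q = ≡se⇒≡sa λ _ _ _ → P⇔Q

≢sa-by-SEModel : ∀ {P Q X Y} → X ⊆ Y → SEModel P X Y → ¬ SEModel Q X Y → ¬ (P ≡sa Q)
≢sa-by-SEModel X⊆Y P-model ¬Q-model P≡Q = ¬Q-model (to (≡sa⇒≡se P≡Q _ _ X⊆Y) P-model)

mask : Bool → Bool → Bool → Mask
mask h p n hd  = h
mask h p n pos = p
mask h p n neg = n

InI-head : ∀ {r T m N c} k → m k ≡ true → InI (r ∷ T) (m ∷ N) c → c ∈ comp r k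
InI-head k m-k (c∈r ∷ _) = from (c∈r k) m-k

falsity : Program
falsity = [ mkRule [] [] [] ]

tautology : Program
tautology = [ mkRule [ 0 ] [ 0 ] [] ]

oneOf01 : Program
oneOf01 = mkRule (0 ∷ 1 ∷ []) [] [] ∷ mkRule [] (0 ∷ 1 ∷ []) [] ∷ []

assertDeny1 : Program
assertDeny1 = mkRule [ 1 ] [] [] ∷ mkRule [] [ 1 ] [] ∷ []

deny0 : Program
deny0 = [ mkRule [] [ 0 ] [] ]

falsity-unsat : ∀ {X Y} → ¬ SEModel falsity X Y
falsity-unsat ((inj₂ (inj₁ []⊈Y) ∷ []) , _) = []⊈Y λ ()

assertDeny1-unsat : ∀ {X Y} → ¬ SEModel assertDeny1 X Y
assertDeny1-unsat ((inj₁ (here 1∈Y) ∷ inj₂ (inj₁ [1]⊈Y) ∷ []) , _) = [1]⊈Y λ { (here refl) → 1∈Y }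
assertDeny1-unsat ((inj₂ (inj₁ []⊈Y) ∷ _) , _)                        = []⊈Y λ ()

tautology-valid : ∀ {X Y} → SEModel tautology X Y
tautology-valid {X} {Y} = from (⊨⇔⊨[self] _) (λ _ → loop Y) ∷ [] , (λ _ → loop X) ∷ []
  where
  loop : ∀ Z → Meets [ 0 ] Z ⊎ ¬ ([ 0 ] ⊆ Z)
  loop Z with 0 ∈? Z
  ... | yes 0∈Z = inj₁ (here 0∈Z)
  ... | no 0∉Z  = inj₂ λ [0]⊆Z → 0∉Z ([0]⊆Z (here refl))

tautology≡[] : tautology ≡sa []
tautology≡[] = ≡sa-by-SEModels (mk⇔ (λ _ → [] , []) (λ _ → tautology-valid))

falsity≢[] : ¬ (falsity ≡sa [])
falsity≢[] falsity≡[] =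
  ≢sa-by-SEModel {X = []} {Y = []} id ([] , []) falsity-unsat (≡sa-sym {falsity} {[]} falsity≡[])

oneOf01≢falsity : ¬ (oneOf01 ≡sa falsity)
oneOf01≢falsity = ≢sa-by-SEModel id (from-yes (SEModel? oneOf01 [ 0 ] [ 0 ])) falsity-unsat

assertDeny1≡falsity : assertDeny1 ≡sa falsity
assertDeny1≡falsity = ≡sa-by-SEModels (mk⇔ (⊥-elim ∘ assertDeny1-unsat) (⊥-elim ∘ falsity-unsat))

H₁B⁺₂ : List Mask
H₁B⁺₂ = mask true false false ∷ mask false true false ∷ mask false false false ∷ []

¬NSEPreserving-S-RD-2 : ¬ NSEPreserving S-RD-2
¬NSEPreserving-S-RD-2 nse = nse oneOf01 falsity _ deletion oneOf01≢falsity assertDeny1≡falsity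
  where
  T : Program
  T = oneOf01 ++ falsity
  deletion : Trans S-RD-2 T (deleteT 0 T)
  deletion = H₁B⁺₂ , 0 , here (hd , refl) ,
             (1 , (λ ()) , from-yes (InI? T H₁B⁺₂ 0) , from-yes (InI? T H₁B⁺₂ 1) ,
              λ c c∈I → case InI-head hd refl c∈I of λ
                { (here c≡0) → inj₁ c≡0 ; (there (here c≡1)) → inj₂ c≡1 }) ,
             refl

¬SEPreserving-S-EX-1 : ¬ SEPreserving S-EX-1
¬SEPreserving-S-EX-1 se = oneOf01≢falsity (se assertDeny1 falsity _ extension assertDeny1≡falsity)
  where
  T : Program
  T = assertDeny1 ++ falsity
  extension : Trans S-EX-1 T (addT H₁B⁺₂ 0 T)
  extension = H₁B⁺₂ , 0 , here (hd , refl) , refl ,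
              (1 , from-yes (InI? T H₁B⁺₂ 1) ,
               λ c c∈I → case InI-head hd refl c∈I of λ { (here c≡1) → c≡1 }) ,
              from-no (occurs? 0 T) , refl

¬SEPreserving-S-RD-1 : ¬ SEPreserving S-RD-1
¬SEPreserving-S-RD-1 se = falsity≢[] (se tautology [] _ deletion tautology≡[])
  where
  N : List Mask
  N = [ mask true true false ]
  deletion : Trans S-RD-1 tautology (deleteT 0 tautology)
  deletion = N , 0 , here (hd , refl) ,
             (from-yes (InI? tautology N 0) ,
              λ c c∈I → case InI-head hd refl c∈I of λ { (here c≡0) → c≡0 }) ,
             refl

¬NSEPreserving-S-RD-1 : ¬ NSEPreserving S-RD-1
¬NSEPreserving-S-RD-1 nse = nse deny0 falsity _ deletion deny0≢falsity (≡sa-refl falsity)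
  where
  T : Program
  T = deny0 ++ falsity
  N : List Mask
  N = mask false true false ∷ mask false false false ∷ []
  deletion : Trans S-RD-1 T (deleteT 0 T)
  deletion = N , 0 , here (pos , refl) ,
             (from-yes (InI? T N 0) ,
              λ c c∈I → case InI-head pos refl c∈I of λ { (here c≡0) → c≡0 }) ,
             refl
  deny0≢falsity : ¬ (deny0 ≡sa falsity)
  deny0≢falsity = ≢sa-by-SEModel id (from-yes (SEModel? deny0 [] [])) falsity-unsat

¬SEPreserving-S-EX-0 : ¬ SEPreserving S-EX-0
¬SEPreserving-S-EX-0 se = fact0≢falsity (se falsity falsity _ extension (≡sa-refl falsity))
  where
  T : Program
  T = falsity ++ falsity
  N : List Mask
  N = mask true false false ∷ mask false false false ∷ []
  extension : Trans S-EX-0 T (addT N 0 T)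
  extension = N , 0 , here (hd , refl) , refl , (λ b b∈I → case InI-head hd refl b∈I of λ ()) ,
              from-no (occurs? 0 T) , refl
  fact0≢falsity : ¬ ([ fact 0 ] ≡sa falsity)
  fact0≢falsity = ≢sa-by-SEModel id (from-yes (SEModel? [ fact 0 ] [ 0 ] [ 0 ])) falsity-unsat

¬NSEPreserving-S-EX-0 : ¬ NSEPreserving S-EX-0
¬NSEPreserving-S-EX-0 nse = nse falsity [] _ extension falsity≢[] tautology≡[]
  where
  N : List Mask
  N = [ mask true true false ]
  extension : Trans S-EX-0 falsity (addT N 0 falsity)
  extension = N , 0 , here (hd , refl) , refl , (λ b b∈I → case InI-head hd refl b∈I of λ ()) ,
              from-no (occurs? 0 falsity) , refl

theorem7 : ((SEPreserving S-RP × NSEPreserving S-RP) ×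
    (SEPreserving S-DL × NSEPreserving S-DL) ×
    (SEPreserving S-AD × NSEPreserving S-AD)) ×
    (SEPreserving S-RD-2 × ¬ NSEPreserving S-RD-2) ×
    (NSEPreserving S-EX-1 × ¬ SEPreserving S-EX-1) ×
    ((¬ SEPreserving S-RD-1 × ¬ NSEPreserving S-RD-1) ×
     (¬ SEPreserving S-EX-0 × ¬ NSEPreserving S-EX-0))
theorem7 =
  ( (SEPreserving-by S-RP S-RP-back , NSEPreserving-by S-RP S-RP-forth)
  , (SEPreserving-by S-DL S-DL-back , NSEPreserving-by S-DL S-DL-forth)
  , (SEPreserving-by S-AD S-AD-back , NSEPreserving-by S-AD S-AD-forth) )
  , (SEPreserving-by S-RD-2 S-RD-2-back , ¬NSEPreserving-S-RD-2)
  , (NSEPreserving-by S-EX-1 S-EX-1-forth , ¬SEPreserving-S-EX-1)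
  , ( (¬SEPreserving-S-RD-1 , ¬NSEPreserving-S-RD-1)
    , (¬SEPreserving-S-EX-0 , ¬NSEPreserving-S-EX-0) )
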